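{- Fix a positive integer $t$, let $k$ be a positive integer, and let $X\subseteq[2^kt]$ be a set of $s$ integers. Then the probability, for an ordering $\pi$ of $[2^kt]$ drawn from $\mathcal{D}_k$, that $\{\pi(1),\dots,\pi(s)\}=X$ is either $0$ or at least $2^{ -2k^2t}$.
   Context: Fix a positive integer $t$. For each positive integer $k$, $\mathcal{D}_k$ is a distribution on orderings $(\pi(1),\dots,\pi(2^kt))$ of $[2^kt]$ defined recursively. To draw an ordering of a set $S$ of $2^kt$ integers from $\mathcal{D}_k$, draw an ordering of $[2^kt]$ from $\mathcal{D}_k$ and relabel via the order-preserving bijection $[2^kt]\to S$. $\mathcal{D}_1$ is the uniform distribution on orderings of $[2t]$. For $k>1$: let $A_0=[2^{k-1}t]$ and $A_1=[2^kt]\setminus[2^{k-1}t]$; independently draw orderings $\sigma_0$ of $A_0$ and $\sigma_1$ of $A_1$ from $\mathcal{D}_{k-1}$; let $m=2^{k-1}t-t$; let $S'$ be the union of the last $t$ elements of $\sigma_0$ and the last $t$ elements of $\sigma_1$, and let $(s'_1,\dots,s'_{2t})$ be an independent uniformly random ordering of $S'$. The output ordering is $\sigma_0(1),\dots,\sigma_0(m),\sigma_1(1),\dots,\sigma_1(m),s'_1,\dots,s'_{2t}$. -}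

module Defs where

open import Data.Nat using (ℕ; zero; suc; _+_; _*_; _∸_; _^_; _≤_)
open import Data.Nat.Properties using (_≟_)
open import Data.List using (List; []; _∷_; map; concatMap; _++_; take; drop; upTo; length; filter)
open import Data.Product using (_×_)
open import Data.List.Relation.Binary.Subset.Propositional using (_⊆_)
open import Data.List.Relation.Binary.Subset.DecPropositional _≟_ using (_⊆?_)
open import Relation.Nullary.Decidable using (_×-dec_)

insertions : {A : Set} → A → List A → List (List A)
insertions x []       = (x ∷ []) ∷ []
insertions x (y ∷ ys) = (x ∷ y ∷ ys) ∷ map (y ∷_) (insertions x ys)

perms : {A : Set} → List A → List (List A)
perms []       = [] ∷ []
perms (x ∷ xs) = concatMap (insertions x) (perms xs)

range : ℕ → List ℕ
range n = map suc (upTo n)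

-- A finite probability distribution all of whose atoms have equal weight
-- is represented by the list of its equally likely outcomes (with multiplicity).
-- Dsuc t n  represents  D_{n+1}  (orderings of [2^(n+1) t]).
Dsuc : ℕ → ℕ → List (List ℕ)
Dsuc t zero    = perms (range (2 * t))
Dsuc t (suc n) =
  concatMap (λ σ₀ →
    concatMap (λ σ₁ →
      map (λ s' → take m σ₀ ++ take m σ₁ ++ s')
          (perms (drop m σ₀ ++ drop m σ₁)))
      (map (map (_+ M)) (Dsuc t n)))   -- relabel [M] → A₁ = {M+1,…,2M}
    (Dsuc t n)
  where
  M = 2 ^ (suc n) * t      -- |A₀| = 2^(k-1) t, with k = n + 2
  m = M ∸ t

-- D t k : the list of equally likely outcomes of 𝒟_k (k ≥ 1); D t 0 is unused.
D : ℕ → ℕ → List (List ℕ)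
D t zero    = []
D t (suc n) = Dsuc t n

Event : List ℕ → List ℕ → Set
Event X π = (take (length X) π ⊆ X) × (X ⊆ take (length X) π)

count : ℕ → ℕ → List ℕ → ℕ
count t k X = length (filter (λ π → (take (length X) π ⊆? X) ×-dec (X ⊆? take (length X) π)) (D t k))

module Submission where

-- For an ordering  π  of  [N], that event says exactly that the first  s  entries of  π
-- lie in  X.  So for an arbitrary Boolean predicate  p  we count the outcomes of
-- 𝒟_{n+1} whose first  s  entries satisfy  p  ("hits") and prove by induction on  n
-- that they are none or at least a  2^-(2(n+1)²t)  fraction of all outcomes
-- (hits-bound).  An outcome of 𝒟_{n+2} consists of the first  m  entries of  σ₀, the
-- first  m  entries of  σ₁  and a shuffle of the remaining  2t  entries (the pool).
-- For  s ≤ m  the fraction of hits is that of 𝒟_{n+1}; for  m < s ≤ 2m  it is a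
-- product of a fraction for  σ₀  at the boundary  s = m  and one for  σ₁; for  s > 2m
-- every admissible pair contributes the shuffles of its pool with a good prefix,
-- a fixed fraction of all shuffles by binomial estimates (goodPerms-bound).  The
-- boundary  s = m  needs the sharper bound  4^-(n+1)y, with  y ≤ t  the number of
-- elements failing  p  (boundary-bound), proved by the same decomposition.

open import Defs
open import Data.Nat using (ℕ; zero; suc; _+_; _*_; _∸_; _^_; _≤_; _<_; z≤n; s≤s; _!; >-nonZero)
open import Data.Nat.Divisibility using (_∣_; ∣⇒≤)
open import Data.Nat.Combinatorics using (k![n∸k]!∣n!)
open import Data.Nat.Properties
open import Relation.Nullary using (Dec; yes; no; does; ¬?)
open import Function using (case_of_)
open import Data.Product using (_×_; _,_)
open import Data.List.Membership.Propositional using (_∈_)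
open import Data.List.Membership.DecPropositional _≟_ using (_∈?_)
open import Data.List.Membership.Propositional.Properties using (∈-filter⁺; ∈-map⁺; ∈-upTo⁺)
open import Data.List.Relation.Unary.Any as Any using (here; there)
open import Data.List.Relation.Unary.AllPairs using ([]; _∷_)
open import Data.List.Relation.Unary.Unique.Propositional using (Unique)
import Data.List.Relation.Unary.Unique.Propositional.Properties as Unique
open import Data.List.Relation.Binary.Subset.Propositional using (_⊆_)
open import Data.List.Relation.Binary.Permutation.Setoid.Properties using (Unique-resp-↭)
open import Data.Bool using (Bool; true; false; _∧_)
open import Data.Bool.Properties using (∧-assoc)
open import Data.List using (List; []; _∷_; length; map; concatMap; _++_; take; drop; upTo; applyUpTo; filter)
open import Data.List.Properties using (length-++; ++-assoc; length-take; length-drop; filter-notAll; length-map; take++drop≡id; length-upTo; map-upTo; map-applyUpTo)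
open import Data.List.Relation.Unary.All as All using (All; []; _∷_)
import Data.List.Relation.Unary.All.Properties as All
open import Data.List.Relation.Binary.Permutation.Propositional as Perm using (_↭_; ↭⇒↭ₛ; module PermutationReasoning)
open import Data.List.Relation.Binary.Permutation.Propositional.Properties using (↭-length; ++⁺ˡ; ++⁺; shifts; map⁺)
open import Data.Empty using (⊥; ⊥-elim)
open import Data.Sum using (_⊎_; inj₁; inj₂)
open import Relation.Binary.PropositionalEquality using (_≡_; _≢_; refl; setoid; sym; trans; cong; cong₂; subst; subst₂; module ≡-Reasoning)
open import Data.Nat.Tactic.RingSolver using (solve-∀)

infix 8 [_]×_
[_]×_ : Bool → ℕ → ℕ
[ true  ]× K = K
[ false ]× K = 0

[]×-assocʳ : ∀ b K L → [ b ]× K * L ≡ [ b ]× (K * L)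
[]×-assocʳ true  K L = refl
[]×-assocʳ false K L = refl

[]×-commˡ : ∀ b K L → K * [ b ]× L ≡ [ b ]× (K * L)
[]×-commˡ true  K L = refl
[]×-commˡ false K L = *-zeroʳ K

[]×-∧ : ∀ a b K → [ a ∧ b ]× K ≡ [ a ]× [ b ]× K
[]×-∧ true  b K = refl
[]×-∧ false b K = refl

countᵇ : {A : Set} → (A → Bool) → List A → ℕ
countᵇ f []       = 0
countᵇ f (x ∷ xs) = [ f x ]× 1 + countᵇ f xs

sumOf : {A : Set} → (A → ℕ) → List A → ℕ
sumOf f []       = 0
sumOf f (x ∷ xs) = f x + sumOf f xs

module _ {A : Set} where

  countᵇ-++ : (f : A → Bool) (xs ys : List A) → countᵇ f (xs ++ ys) ≡ countᵇ f xs + countᵇ f ys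
  countᵇ-++ f []       ys = refl
  countᵇ-++ f (x ∷ xs) ys = trans (cong ([ f x ]× 1 +_) (countᵇ-++ f xs ys)) (sym (+-assoc ([ f x ]× 1) _ _))

  countᵇ-map : {B : Set} (f : A → Bool) (g : B → A) (xs : List B) → countᵇ f (map g xs) ≡ countᵇ (λ x → f (g x)) xs
  countᵇ-map f g []       = refl
  countᵇ-map f g (x ∷ xs) = cong ([ f (g x) ]× 1 +_) (countᵇ-map f g xs)

  countᵇ-concatMap : {B : Set} (f : A → Bool) (g : B → List A) (xs : List B) →
                     countᵇ f (concatMap g xs) ≡ sumOf (λ x → countᵇ f (g x)) xs
  countᵇ-concatMap f g []       = refl
  countᵇ-concatMap f g (x ∷ xs) =
    trans (countᵇ-++ f (g x) (concatMap g xs)) (cong (countᵇ f (g x) +_) (countᵇ-concatMap f g xs))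

  length-concatMap : {B : Set} (g : B → List A) (xs : List B) → length (concatMap g xs) ≡ sumOf (λ x → length (g x)) xs
  length-concatMap g []       = refl
  length-concatMap g (x ∷ xs) = trans (length-++ (g x)) (cong (length (g x) +_) (length-concatMap g xs))

  countᵇ-≤ : (f : A → Bool) (xs : List A) → countᵇ f xs ≤ length xs
  countᵇ-≤ f []       = z≤n
  countᵇ-≤ f (x ∷ xs) with f x
  ... | true  = s≤s (countᵇ-≤ f xs)
  ... | false = m≤n⇒m≤1+n (countᵇ-≤ f xs)

  countᵇ-const : (c : Bool) (xs : List A) → countᵇ (λ _ → c) xs ≡ [ c ]× length xs
  countᵇ-const true  []       = refl
  countᵇ-const true  (x ∷ xs) = cong suc (countᵇ-const true xs)
  countᵇ-const false []       = refl
  countᵇ-const false (x ∷ xs) = countᵇ-const false xs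

  countᵇ-∧ : (c : Bool) (f : A → Bool) (xs : List A) → countᵇ (λ x → c ∧ f x) xs ≡ [ c ]× countᵇ f xs
  countᵇ-∧ true  f xs = refl
  countᵇ-∧ false f xs = countᵇ-const false xs

  countᵇ-cong : {f g : A → Bool} → (∀ x → f x ≡ g x) → (xs : List A) → countᵇ f xs ≡ countᵇ g xs
  countᵇ-cong h []       = refl
  countᵇ-cong h (x ∷ xs) = cong₂ _+_ (cong ([_]× 1) (h x)) (countᵇ-cong h xs)

  countᵇ-none : (f : A → Bool) (xs : List A) → All (λ x → f x ≡ false) xs → countᵇ f xs ≡ 0
  countᵇ-none f []       []       = refl
  countᵇ-none f (x ∷ xs) (h ∷ hs) rewrite h = countᵇ-none f xs hs

  countᵇ-↭ : (f : A → Bool) {xs ys : List A} → xs ↭ ys → countᵇ f xs ≡ countᵇ f ys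
  countᵇ-↭ f Perm.refl        = refl
  countᵇ-↭ f (Perm.prep x p)  = cong ([ f x ]× 1 +_) (countᵇ-↭ f p)
  countᵇ-↭ f (Perm.swap {xs = xs} {ys = ys} x y p) = begin
    [ f x ]× 1 + ([ f y ]× 1 + countᵇ f xs) ≡⟨ sym (+-assoc ([ f x ]× 1) _ _) ⟩
    [ f x ]× 1 + [ f y ]× 1 + countᵇ f xs   ≡⟨ cong₂ _+_ (+-comm ([ f x ]× 1) _) (countᵇ-↭ f p) ⟩
    [ f y ]× 1 + [ f x ]× 1 + countᵇ f ys   ≡⟨ +-assoc ([ f y ]× 1) _ _ ⟩
    [ f y ]× 1 + ([ f x ]× 1 + countᵇ f ys) ∎
    where open ≡-Reasoning
  countᵇ-↭ f (Perm.trans p q) = trans (countᵇ-↭ f p) (countᵇ-↭ f q)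

  sumOf-map : {B : Set} (f : A → ℕ) (g : B → A) (xs : List B) → sumOf f (map g xs) ≡ sumOf (λ x → f (g x)) xs
  sumOf-map f g []       = refl
  sumOf-map f g (x ∷ xs) = cong (f (g x) +_) (sumOf-map f g xs)

  sumOf-cong : {f g : A → ℕ} (xs : List A) → All (λ x → f x ≡ g x) xs → sumOf f xs ≡ sumOf g xs
  sumOf-cong []       []       = refl
  sumOf-cong (x ∷ xs) (h ∷ hs) = cong₂ _+_ h (sumOf-cong xs hs)

  sumOf-const : (K : ℕ) (xs : List A) → sumOf (λ _ → K) xs ≡ length xs * K
  sumOf-const K []       = refl
  sumOf-const K (x ∷ xs) = cong (K +_) (sumOf-const K xs)

  sumOf-+ : (f g : A → ℕ) (xs : List A) → sumOf (λ x → f x + g x) xs ≡ sumOf f xs + sumOf g xs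
  sumOf-+ f g []       = refl
  sumOf-+ f g (x ∷ xs) = trans (cong (f x + g x +_) (sumOf-+ f g xs)) (interchange (f x) (g x) (sumOf f xs) (sumOf g xs))
    where
    interchange : ∀ a b c d → a + b + (c + d) ≡ a + c + (b + d)
    interchange = solve-∀

  sumOf-guard : (b : A → Bool) (K : ℕ) (xs : List A) → sumOf (λ x → [ b x ]× K) xs ≡ countᵇ b xs * K
  sumOf-guard b K []       = refl
  sumOf-guard b K (x ∷ xs) with b x
  ... | true  = cong (K +_) (sumOf-guard b K xs)
  ... | false = sumOf-guard b K xs

  sumOf-guardOut : (c : Bool) (g : A → ℕ) (xs : List A) → sumOf (λ x → [ c ]× g x) xs ≡ [ c ]× sumOf g xs
  sumOf-guardOut true  g xs = refl
  sumOf-guardOut false g xs = trans (sumOf-const 0 xs) (*-zeroʳ (length xs))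

  module _ {V : A → Set} (c : A → Bool) (g : A → ℕ) where

    guardedSum-≤ : (X : ℕ) (xs : List A) → All V xs → (∀ x → V x → g x ≤ X) →
                   sumOf (λ x → [ c x ]× g x) xs ≤ countᵇ c xs * X
    guardedSum-≤ X []       []       h = z≤n
    guardedSum-≤ X (x ∷ xs) (v ∷ vs) h with c x
    ... | true  = +-mono-≤ (h x v) (guardedSum-≤ X xs vs h)
    ... | false = guardedSum-≤ X xs vs h

    guardedSum-≥ : (X C : ℕ) (xs : List A) → All V xs → (∀ x → V x → c x ≡ true → X ≤ C * g x) →
                   countᵇ c xs * X ≤ C * sumOf (λ x → [ c x ]× g x) xs
    guardedSum-≥ X C []       []       h = ≤-reflexive (sym (*-zeroʳ C))
    guardedSum-≥ X C (x ∷ xs) (v ∷ vs) h with c x in eq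
    ... | true  = subst (X + countᵇ c xs * X ≤_) (sym (*-distribˡ-+ C (g x) _))
                        (+-mono-≤ (h x v eq) (guardedSum-≥ X C xs vs h))
    ... | false = guardedSum-≥ X C xs vs h

    guardedSum-0 : (xs : List A) → All V xs → (∀ x → V x → c x ≡ true → g x ≡ 0) →
                   sumOf (λ x → [ c x ]× g x) xs ≡ 0
    guardedSum-0 []       []       h = refl
    guardedSum-0 (x ∷ xs) (v ∷ vs) h with c x in eq
    ... | true  = trans (cong (_+ sumOf (λ x → [ c x ]× g x) xs) (h x v eq)) (guardedSum-0 xs vs h)
    ... | false = guardedSum-0 xs vs h

prefixAll : (ℕ → Bool) → ℕ → List ℕ → Bool
prefixAll p zero    _        = true
prefixAll p (suc s) []       = true
prefixAll p (suc s) (x ∷ xs) = p x ∧ prefixAll p s xs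

module _ (p : ℕ → Bool) where

  prefixAll-++ : ∀ (a b : List ℕ) {n} k → length a ≡ n → prefixAll p (n + k) (a ++ b) ≡ (prefixAll p n a ∧ prefixAll p k b)
  prefixAll-++ []      b k refl = refl
  prefixAll-++ (x ∷ a) b k refl = trans (cong (p x ∧_) (prefixAll-++ a b k refl)) (sym (∧-assoc (p x) _ _))

  prefixAll-++ˡ : ∀ (a b : List ℕ) s → s ≤ length a → prefixAll p s (a ++ b) ≡ prefixAll p s a
  prefixAll-++ˡ a       b zero    h       = refl
  prefixAll-++ˡ (x ∷ a) b (suc s) (s≤s h) = cong (p x ∧_) (prefixAll-++ˡ a b s h)

  prefixAll-take : ∀ s m (xs : List ℕ) → s ≤ m → prefixAll p s (take m xs) ≡ prefixAll p s xs
  prefixAll-take zero    m       xs       h       = refl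
  prefixAll-take (suc s) (suc m) []       h       = refl
  prefixAll-take (suc s) (suc m) (x ∷ xs) (s≤s h) = cong (p x ∧_) (prefixAll-take s m xs h)

  prefixAll⇒count-take : ∀ s (xs : List ℕ) → prefixAll p s xs ≡ true → s ≤ length xs → countᵇ p (take s xs) ≡ s
  prefixAll⇒count-take zero    xs       h l       = refl
  prefixAll⇒count-take (suc s) (x ∷ xs) h (s≤s l) with p x
  ... | true = cong suc (prefixAll⇒count-take s xs h l)

  count-drop : ∀ m (xs : List ℕ) → prefixAll p m xs ≡ true → m ≤ length xs → countᵇ p (drop m xs) + m ≡ countᵇ p xs
  count-drop m xs h l = begin
    countᵇ p (drop m xs) + m                       ≡⟨ +-comm _ m ⟩
    m + countᵇ p (drop m xs)                       ≡⟨ cong (_+ countᵇ p (drop m xs)) (prefixAll⇒count-take m xs h l) ⟨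
    countᵇ p (take m xs) + countᵇ p (drop m xs)    ≡⟨ countᵇ-++ p (take m xs) (drop m xs) ⟨
    countᵇ p (take m xs ++ drop m xs)              ≡⟨ cong (countᵇ p) (take++drop≡id m xs) ⟩
    countᵇ p xs                                    ∎
    where open ≡-Reasoning

  prefixAll⇒≤count : ∀ s (xs : List ℕ) → prefixAll p s xs ≡ true → s ≤ length xs → s ≤ countᵇ p xs
  prefixAll⇒≤count s xs h l = subst (s ≤_) (count-drop s xs h l) (m≤n+m s _)

module _ (p : ℕ → Bool) {m} (σ τ : List ℕ) (m≤σ : m ≤ length σ) where

  private
    length-block : length (take m σ) ≡ m
    length-block = trans (length-take m σ) (m≤n⇒m⊓n≡m m≤σ)

  prefixAll-within : ∀ s → s ≤ m → prefixAll p s (take m σ ++ τ) ≡ prefixAll p s σ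
  prefixAll-within s s≤m = trans (prefixAll-++ˡ p (take m σ) τ s (subst (s ≤_) (sym length-block) s≤m))
                                 (prefixAll-take p s m σ s≤m)

  prefixAll-beyond : ∀ s → prefixAll p (m + s) (take m σ ++ τ) ≡ (prefixAll p m σ ∧ prefixAll p s τ)
  prefixAll-beyond s = trans (prefixAll-++ p (take m σ) τ s length-block)
                             (cong (_∧ prefixAll p s τ) (prefixAll-take p m m σ ≤-refl))

prefixAll-map : ∀ (p : ℕ → Bool) (f : ℕ → ℕ) s (xs : List ℕ) → prefixAll p s (map f xs) ≡ prefixAll (λ z → p (f z)) s xs
prefixAll-map p f zero    xs       = refl
prefixAll-map p f (suc s) []       = refl
prefixAll-map p f (suc s) (x ∷ xs) = cong (p (f x) ∧_) (prefixAll-map p f s xs)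

insertions-↭ : (x : ℕ) (ys : List ℕ) → All (λ π → π ↭ x ∷ ys) (insertions x ys)
insertions-↭ x []       = Perm.refl ∷ []
insertions-↭ x (y ∷ ys) =
  Perm.refl ∷ All.map⁺ (All.map (λ h → Perm.trans (Perm.prep y h) (Perm.swap y x Perm.refl)) (insertions-↭ x ys))

perms-↭ : (l : List ℕ) → All (λ π → π ↭ l) (perms l)
perms-↭ []       = Perm.refl ∷ []
perms-↭ (x ∷ xs) = All.concat⁺ (All.map⁺ (All.map (λ {π} h →
  All.map (λ h' → Perm.trans h' (Perm.prep x h)) (insertions-↭ x π)) (perms-↭ xs)))

length-insertions : (x : ℕ) (ys : List ℕ) → length (insertions x ys) ≡ suc (length ys)
length-insertions x []       = refl
length-insertions x (y ∷ ys) = cong suc (trans (length-map (y ∷_) (insertions x ys)) (length-insertions x ys))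

length-perms : (l : List ℕ) → length (perms l) ≡ length l !
length-perms []       = refl
length-perms (x ∷ xs) = begin
  length (concatMap (insertions x) (perms xs))     ≡⟨ length-concatMap (insertions x) (perms xs) ⟩
  sumOf (λ π → length (insertions x π)) (perms xs) ≡⟨ sumOf-cong (perms xs) (All.map (λ {π} h →
                                                         trans (length-insertions x π) (cong suc (↭-length h))) (perms-↭ xs)) ⟩
  sumOf (λ _ → suc (length xs)) (perms xs)          ≡⟨ sumOf-const (suc (length xs)) (perms xs) ⟩
  length (perms xs) * suc (length xs)              ≡⟨ cong (_* suc (length xs)) (length-perms xs) ⟩
  length xs ! * suc (length xs)                    ≡⟨ *-comm (length xs !) _ ⟩
  suc (length xs) * length xs !                    ∎
  where open ≡-Reasoning

prefixAll-impossible : ∀ p s (Π : List (List ℕ)) (l : List ℕ) → All (λ π → π ↭ l) Π →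
                       s ≤ length l → countᵇ p l < s → countᵇ (prefixAll p s) Π ≡ 0
prefixAll-impossible p s Π l hΠ hs hc = countᵇ-none (prefixAll p s) Π (All.map refute hΠ)
  where
  refute : ∀ {π} → π ↭ l → prefixAll p s π ≡ false
  refute {π} h with prefixAll p s π in eq
  ... | false = refl
  ... | true  = ⊥-elim (<⇒≱ hc (subst (s ≤_) (countᵇ-↭ p h)
                  (prefixAll⇒≤count p s π eq (subst (s ≤_) (sym (↭-length h)) hs))))

goodPerms : (ℕ → Bool) → List ℕ → ℕ → ℕ
goodPerms p l j = countᵇ (prefixAll p j) (perms l)

goodPerms-0 : ∀ p (l : List ℕ) → goodPerms p l 0 ≡ length l !
goodPerms-0 p l = trans (countᵇ-const true (perms l)) (length-perms l)

module _ (p : ℕ → Bool) where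

  -- Inserting  x  into  π  (of length  j + b) at one of the first  j + 1  positions puts  x
  -- among the first  j + 1  entries; at one of the remaining  b  positions it leaves them as in  π.
  countᵇ-insertions : ∀ (x : ℕ) (π : List ℕ) j b → j + b ≡ length π →
    countᵇ (prefixAll p (suc j)) (insertions x π) ≡ [ p x ∧ prefixAll p j π ]× suc j + [ prefixAll p (suc j) π ]× b
  countᵇ-insertions x [] zero zero h with p x
  ... | true  = refl
  ... | false = refl
  countᵇ-insertions x (y ∷ ys) zero b h
    rewrite countᵇ-map (prefixAll p 1) (y ∷_) (insertions x ys) | countᵇ-∧ (p y) (λ _ → true) (insertions x ys)
          | countᵇ-const true (insertions x ys) | length-insertions x ys | h
    with p x | p y
  ... | true  | true  = refl
  ... | true  | false = refl
  ... | false | true  = refl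
  ... | false | false = refl
  countᵇ-insertions x (y ∷ ys) (suc j) b h
    rewrite countᵇ-map (prefixAll p (suc (suc j))) (y ∷_) (insertions x ys)
          | countᵇ-∧ (p y) (prefixAll p (suc j)) (insertions x ys) | countᵇ-insertions x ys j b (suc-injective h)
    with p x | p y | prefixAll p j ys
  ... | true  | true  | true  = refl
  ... | true  | true  | false = refl
  ... | true  | false | _     = refl
  ... | false | true  | _     = refl
  ... | false | false | _     = refl

  goodPerms-step : ∀ x (xs : List ℕ) j b → j + b ≡ length xs →
                   goodPerms p (x ∷ xs) (suc j) ≡ [ p x ]× (goodPerms p xs j * suc j) + goodPerms p xs (suc j) * b
  goodPerms-step x xs j b h = begin
    countᵇ (prefixAll p (suc j)) (concatMap (insertions x) (perms xs))
      ≡⟨ countᵇ-concatMap (prefixAll p (suc j)) (insertions x) (perms xs) ⟩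
    sumOf (λ π → countᵇ (prefixAll p (suc j)) (insertions x π)) (perms xs)
      ≡⟨ sumOf-cong (perms xs) (All.map (λ {π} hπ → countᵇ-insertions x π j b (trans h (sym (↭-length hπ)))) (perms-↭ xs)) ⟩
    sumOf (λ π → [ p x ∧ prefixAll p j π ]× suc j + [ prefixAll p (suc j) π ]× b) (perms xs)
      ≡⟨ sumOf-+ (λ π → [ p x ∧ prefixAll p j π ]× suc j) (λ π → [ prefixAll p (suc j) π ]× b) (perms xs) ⟩
    sumOf (λ π → [ p x ∧ prefixAll p j π ]× suc j) (perms xs) + sumOf (λ π → [ prefixAll p (suc j) π ]× b) (perms xs)
      ≡⟨ cong₂ _+_ (sumOf-guard (λ π → p x ∧ prefixAll p j π) (suc j) (perms xs))
                   (sumOf-guard (prefixAll p (suc j)) b (perms xs)) ⟩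
    countᵇ (λ π → p x ∧ prefixAll p j π) (perms xs) * suc j + goodPerms p xs (suc j) * b
      ≡⟨ cong (λ z → z * suc j + goodPerms p xs (suc j) * b) (countᵇ-∧ (p x) (prefixAll p j) (perms xs)) ⟩
    [ p x ]× goodPerms p xs j * suc j + goodPerms p xs (suc j) * b
      ≡⟨ cong (_+ goodPerms p xs (suc j) * b) ([]×-assocʳ (p x) (goodPerms p xs j) (suc j)) ⟩
    [ p x ]× (goodPerms p xs j * suc j) + goodPerms p xs (suc j) * b ∎
    where open ≡-Reasoning

  private
    overfull : ∀ {j k} → j < k → k ≤ j + 0 → ⊥
    overfull {j} j<k k≤j = <⇒≱ j<k (≤-trans k≤j (≤-reflexive (+-identityʳ j)))

    firstSlots : ∀ {j B G X} → (j + 0) ! * B ≤ G * 1 → (suc j + 0) ! * B ≤ (G * suc j + X) * 1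
    firstSlots {j} {B} {G} {X} h rewrite +-identityʳ j = begin
      suc j * j ! * B     ≡⟨ *-assoc (suc j) (j !) B ⟩
      suc j * (j ! * B)   ≤⟨ *-monoʳ-≤ (suc j) h ⟩
      suc j * (G * 1)     ≡⟨ reorder (suc j) G ⟩
      G * suc j * 1       ≤⟨ *-monoˡ-≤ 1 (m≤m+n (G * suc j) X) ⟩
      (G * suc j + X) * 1 ∎
      where
      open ≤-Reasoning
      reorder : ∀ k G → k * (G * 1) ≡ G * k * 1
      reorder = solve-∀

    bothSlots : ∀ {j a b C A B G₁ G₂} → C * (suc b * B) ≤ G₁ * (suc a * A) → C * B ≤ G₂ * A →
                suc (j + suc a) * C * (suc b * B) ≤ (G₁ * suc j + G₂ * suc b) * (suc a * A)
    bothSlots {j} {a} {b} {C} {A} {B} {G₁} {G₂} h₁ h₂ = begin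
      suc (j + suc a) * C * (suc b * B)                     ≡⟨ split j a b C B ⟩
      suc j * (C * (suc b * B)) + suc b * suc a * (C * B)   ≤⟨ +-mono-≤ (*-monoʳ-≤ (suc j) h₁)
                                                                         (*-monoʳ-≤ (suc b * suc a) h₂) ⟩
      suc j * (G₁ * (suc a * A)) + suc b * suc a * (G₂ * A) ≡⟨ join j a b A G₁ G₂ ⟩
      (G₁ * suc j + G₂ * suc b) * (suc a * A)               ∎
      where
      open ≤-Reasoning
      split : ∀ j a b C B → suc (j + suc a) * C * (suc b * B) ≡ suc j * (C * (suc b * B)) + suc b * suc a * (C * B)
      split = solve-∀
      join : ∀ j a b A G₁ G₂ → suc j * (G₁ * (suc a * A)) + suc b * suc a * (G₂ * A) ≡ (G₁ * suc j + G₂ * suc b) * (suc a * A)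
      join = solve-∀

    lastSlots : ∀ {b C A B G} → C * B ≤ G * A → C * (suc b * B) ≤ G * suc b * A
    lastSlots {b} {C} {A} {B} {G} h = begin
      C * (suc b * B)   ≡⟨ reorder C (suc b) B ⟩
      suc b * (C * B)   ≤⟨ *-monoʳ-≤ (suc b) h ⟩
      suc b * (G * A)   ≡⟨ regroup (suc b) G A ⟩
      G * suc b * A     ∎
      where
      open ≤-Reasoning
      reorder : ∀ x y z → x * (y * z) ≡ y * (x * z)
      reorder = solve-∀
      regroup : ∀ x y z → x * (y * z) ≡ y * x * z
      regroup = solve-∀

  goodPerms-lower : ∀ (l : List ℕ) j a b → countᵇ p l ≡ j + a → length l ≡ j + b →
                    (j + a) ! * b ! ≤ goodPerms p l j * a !
  goodPerms-lower l zero a b hc hn = ≤-reflexive (begin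
    a ! * b !               ≡⟨ *-comm (a !) (b !) ⟩
    b ! * a !               ≡⟨ cong (λ n → n ! * a !) hn ⟨
    length l ! * a !        ≡⟨ cong (_* a !) (goodPerms-0 p l) ⟨
    goodPerms p l 0 * a ! ∎)
    where open ≡-Reasoning
  goodPerms-lower (x ∷ xs) (suc j) a b hc hn
    rewrite goodPerms-step x xs j b (sym (suc-injective hn))
    with p x | countᵇ-≤ p xs
  goodPerms-lower (x ∷ xs) (suc j) zero b hc hn | true | _ =
    firstSlots {j} {b !} {goodPerms p xs j} (goodPerms-lower xs j 0 b (suc-injective hc) (suc-injective hn))
  goodPerms-lower (x ∷ xs) (suc j) (suc a) zero hc hn | true | c≤n =
    ⊥-elim (overfull (m<m+n j (s≤s z≤n)) (subst₂ _≤_ (suc-injective hc) (suc-injective hn) c≤n))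
  goodPerms-lower (x ∷ xs) (suc j) (suc a) (suc b) hc hn | true | _ =
    bothSlots {j} {a} {b} {(j + suc a) !} {a !} {b !} {goodPerms p xs j} {goodPerms p xs (suc j)}
              (goodPerms-lower xs j (suc a) (suc b) hc' hn')
              (subst (λ k → k ! * b ! ≤ goodPerms p xs (suc j) * a !) (sym (+-suc j a))
                     (goodPerms-lower xs (suc j) a b (trans hc' (+-suc j a)) (trans hn' (+-suc j b))))
    where
    hc' = suc-injective hc
    hn' = suc-injective hn
  goodPerms-lower (x ∷ xs) (suc j) a zero hc hn | false | c≤n =
    ⊥-elim (overfull (s≤s (m≤m+n j a)) (subst₂ _≤_ hc (suc-injective hn) c≤n))
  goodPerms-lower (x ∷ xs) (suc j) a (suc b) hc hn | false | _ =
    lastSlots {b} {(suc j + a) !} {a !} {b !} {goodPerms p xs (suc j)} (goodPerms-lower xs (suc j) a b hc (trans (suc-injective hn) (+-suc j b)))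

factorial-split : ∀ j a → j ! * a ! ≤ (j + a) !
factorial-split j a = ∣⇒≤ {{(j + a) !≢0}}
  (subst (λ k → j ! * k ! ∣ (j + a) !) (m+n∸m≡n j a) (k![n∸k]!∣n! (m≤m+n j a)))

binomial≤2^ : ∀ n j b → j + b ≡ n → n ! ≤ 2 ^ n * (j ! * b !)
binomial≤2^ n zero b refl = begin
  b !                ≡⟨ *-identityˡ (b !) ⟨
  1 * b !            ≤⟨ *-monoˡ-≤ (b !) (m^n>0 2 b) ⟩
  2 ^ b * b !        ≡⟨ cong (2 ^ b *_) (+-identityʳ (b !)) ⟨
  2 ^ b * (1 * b !)  ∎
  where open ≤-Reasoning
binomial≤2^ n (suc j) zero refl = begin
  (suc j + 0) !                      ≡⟨ *-identityˡ _ ⟨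
  1 * (suc j + 0) !                  ≤⟨ *-monoˡ-≤ _ (m^n>0 2 (suc j + 0)) ⟩
  2 ^ (suc j + 0) * (suc j + 0) !    ≡⟨ cong (λ k → 2 ^ (suc j + 0) * k !) (+-identityʳ (suc j)) ⟩
  2 ^ (suc j + 0) * (suc j) !        ≡⟨ cong (2 ^ (suc j + 0) *_) (*-identityʳ _) ⟨
  2 ^ (suc j + 0) * ((suc j) ! * 1)  ∎
  where open ≤-Reasoning
binomial≤2^ zero (suc j) (suc b) ()
binomial≤2^ (suc n) (suc j) (suc b) e = begin
  suc n * n !                 ≡⟨ cong (_* n !) (sym e) ⟩
  (suc j + suc b) * n !       ≡⟨ *-distribʳ-+ (n !) (suc j) (suc b) ⟩
  suc j * n ! + suc b * n !   ≤⟨ +-mono-≤ (*-monoʳ-≤ (suc j) (binomial≤2^ n j (suc b) (suc-injective e)))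
                                          (*-monoʳ-≤ (suc b) (binomial≤2^ n (suc j) b
                                            (trans (sym (+-suc j b)) (suc-injective e)))) ⟩
  suc j * (2 ^ n * (j ! * (suc b * b !))) + suc b * (2 ^ n * ((suc j * j !) * b !))
                              ≡⟨ pascal (suc j) (suc b) (2 ^ n) (j !) (b !) ⟩
  2 * 2 ^ n * ((suc j * j !) * (suc b * b !)) ∎
  where
  open ≤-Reasoning
  pascal : ∀ J B T x y → J * (T * (x * (B * y))) + B * (T * ((J * x) * y)) ≡ 2 * T * ((J * x) * (B * y))
  pascal = solve-∀

half-binomial≤4^ : ∀ u y → (2 * (u + y)) ! * u ! ≤ 2 ^ (2 * y) * ((u + y + u) ! * (u + y) !)
half-binomial≤4^ u zero = ≤-reflexive (begin
  (2 * (u + 0)) ! * u !               ≡⟨ cong₂ (λ a b → a ! * b !) (double u) (+-identityʳ u) ⟨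
  (u + 0 + u) ! * (u + 0) !           ≡⟨ *-identityˡ _ ⟨
  1 * ((u + 0 + u) ! * (u + 0) !)     ∎)
  where
  open ≡-Reasoning
  double : ∀ u → u + 0 + u ≡ 2 * (u + 0)
  double = solve-∀
half-binomial≤4^ u (suc y) = subst₂ _≤_ lhs rhs
  (*-mono-≤ (stepFactor (u + y) u) (half-binomial≤4^ u y))
  where
  T = u + y
  -- passing from y to y + 1 multiplies the left side by (2T+2)(2T+1) and the right one by 4(T+u+1)(T+1)
  stepFactor : ∀ T u → suc (suc (2 * T)) * suc (2 * T) ≤ 4 * suc (T + u) * suc T
  stepFactor T u = subst₂ _≤_ (expandˡ T) (expandʳ T u) (m≤m+n _ _)
    where
    expandˡ : ∀ T → (2 * T + 2) * (2 * T + 1) ≡ suc (suc (2 * T)) * suc (2 * T)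
    expandˡ = solve-∀
    expandʳ : ∀ T u → (2 * T + 2) * (2 * T + 1) + (2 * T + 2) * (2 * u + 1) ≡ 4 * suc (T + u) * suc T
    expandʳ = solve-∀
  lhs : suc (suc (2 * T)) * suc (2 * T) * ((2 * T) ! * u !) ≡ (2 * (u + suc y)) ! * u !
  lhs = trans (regroup (suc (suc (2 * T))) (suc (2 * T)) ((2 * T) !) (u !))
              (cong (λ z → z ! * u !) (sym (twoSuc u y)))
    where
    regroup : ∀ a b c d → a * b * (c * d) ≡ a * (b * c) * d
    regroup = solve-∀
    twoSuc : ∀ u y → 2 * (u + suc y) ≡ suc (suc (2 * (u + y)))
    twoSuc = solve-∀
  rhs : 4 * suc (T + u) * suc T * (2 ^ (2 * y) * ((T + u) ! * T !)) ≡ 2 ^ (2 * suc y) * ((u + suc y + u) ! * (u + suc y) !)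
  rhs = trans (regroup 4 (suc (T + u)) (suc T) (2 ^ (2 * y)) ((T + u) !) (T !))
              (cong₂ _*_ (trans (sym (^-distribˡ-+-* 2 2 (2 * y))) (cong (2 ^_) (sym (twoSuc y))))
                         (cong₂ _*_ (cong _! (sym (sucMid u y))) (cong _! (sym (+-suc u y)))))
    where
    regroup : ∀ a b c d e f → a * b * c * (d * (e * f)) ≡ a * d * (b * e * (c * f))
    regroup = solve-∀
    twoSuc : ∀ y → 2 * suc y ≡ 2 + 2 * y
    twoSuc = solve-∀
    sucMid : ∀ u y → u + suc y + u ≡ suc (u + y + u)
    sucMid = solve-∀

module _ (p : ℕ → Bool) (l : List ℕ) where

  private
    cancel! : ∀ {A B} a → A * a ! ≤ B * a ! → A ≤ B
    cancel! {A} {B} a = *-cancelʳ-≤ A B (a !) {{a !≢0}}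

  goodPerms-bound : ∀ j → j ≤ countᵇ p l → j ≤ length l → length l ! ≤ 2 ^ length l * goodPerms p l j
  goodPerms-bound j j≤c j≤n = cancel! a (begin
    n ! * a !                  ≤⟨ *-monoˡ-≤ (a !) (binomial≤2^ n j b (m+[n∸m]≡n j≤n)) ⟩
    2 ^ n * (j ! * b !) * a !  ≡⟨ swap (2 ^ n) (j !) (b !) (a !) ⟩
    2 ^ n * (j ! * a !) * b !  ≤⟨ *-monoˡ-≤ (b !) (*-monoʳ-≤ (2 ^ n)
                                    (subst (λ k → j ! * a ! ≤ k !) (m+[n∸m]≡n j≤c) (factorial-split j a))) ⟩
    2 ^ n * c ! * b !          ≡⟨ *-assoc (2 ^ n) (c !) (b !) ⟩
    2 ^ n * (c ! * b !)        ≤⟨ *-monoʳ-≤ (2 ^ n) (subst (λ k → k ! * b ! ≤ goodPerms p l j * a !) (m+[n∸m]≡n j≤c)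
                                    (goodPerms-lower p l j a b (sym (m+[n∸m]≡n j≤c)) (sym (m+[n∸m]≡n j≤n)))) ⟩
    2 ^ n * (goodPerms p l j * a !) ≡⟨ *-assoc (2 ^ n) _ _ ⟨
    2 ^ n * goodPerms p l j * a !   ∎)
    where
    open ≤-Reasoning
    n = length l
    c = countᵇ p l
    a = c ∸ j
    b = n ∸ j
    swap : ∀ x y z w → x * (y * z) * w ≡ x * (y * w) * z
    swap = solve-∀

  goodPerms-bound-half : ∀ T y → y ≤ T → length l ≡ T + T → countᵇ p l + y ≡ T + T →
                         (T + T) ! ≤ 2 ^ (2 * y) * goodPerms p l T
  goodPerms-bound-half T y y≤T hn hc with T ∸ y | m∸n+n≡m y≤T
  ... | u | refl = cancel! u (begin
    (T + T) ! * u !                         ≡⟨ cong (λ k → k ! * u !) (double T) ⟩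
    (2 * T) ! * u !                         ≤⟨ half-binomial≤4^ u y ⟩
    2 ^ (2 * y) * ((T + u) ! * T !)         ≤⟨ *-monoʳ-≤ (2 ^ (2 * y)) (goodPerms-lower p l T u T hc' hn) ⟩
    2 ^ (2 * y) * (goodPerms p l T * u !)   ≡⟨ *-assoc (2 ^ (2 * y)) _ _ ⟨
    2 ^ (2 * y) * goodPerms p l T * u !     ∎)
    where
    open ≤-Reasoning
    double : ∀ T → T + T ≡ 2 * T
    double = solve-∀
    shuffle : ∀ u y → u + y + (u + y) ≡ u + y + u + y
    shuffle = solve-∀
    hc' : countᵇ p l ≡ (u + y) + u
    hc' = +-cancelʳ-≡ y _ _ (trans hc (shuffle u y))

length-range : ∀ n → length (range n) ≡ n
length-range n = trans (length-map suc (upTo n)) (length-upTo n)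

range-double : ∀ M → range (M + M) ≡ range M ++ map (_+ M) (range M)
range-double M = begin
  range (M + M)                                        ≡⟨ map-upTo suc (M + M) ⟩
  applyUpTo suc (M + M)                                ≡⟨ applyUpTo-+ suc M M ⟩
  applyUpTo suc M ++ applyUpTo (λ i → suc (M + i)) M   ≡⟨ cong₂ _++_ (sym (map-upTo suc M))
                                                              (applyUpTo-cong (λ i → cong suc (+-comm M i)) M) ⟩
  range M ++ applyUpTo (λ i → suc i + M) M             ≡⟨ cong (range M ++_) (map-applyUpTo suc (_+ M) M) ⟨
  range M ++ map (_+ M) (applyUpTo suc M)              ≡⟨ cong (λ z → range M ++ map (_+ M) z) (map-upTo suc M) ⟨
  range M ++ map (_+ M) (range M)                      ∎
  where
  open ≡-Reasoning
  applyUpTo-+ : (f : ℕ → ℕ) (a b : ℕ) → applyUpTo f (a + b) ≡ applyUpTo f a ++ applyUpTo (λ i → f (a + i)) b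
  applyUpTo-+ f zero    b = refl
  applyUpTo-+ f (suc a) b = cong (f 0 ∷_) (applyUpTo-+ (λ i → f (suc i)) a b)
  applyUpTo-cong : {f g : ℕ → ℕ} → (∀ i → f i ≡ g i) → ∀ n → applyUpTo f n ≡ applyUpTo g n
  applyUpTo-cong h zero    = refl
  applyUpTo-cong h (suc n) = cong₂ _∷_ (h 0) (applyUpTo-cong (λ i → h (suc i)) n)

product-bound : ∀ {L F F₀ F₁ X c A B} → F₀ * (F₁ * X) ≤ 2 ^ c * F → F ≤ F₀ * (F₁ * X) →
                F₀ ≡ 0 ⊎ L ≤ F₀ * 2 ^ A → F₁ ≡ 0 ⊎ L ≤ F₁ * 2 ^ B → F ≡ 0 ⊎ L * (L * X) ≤ F * 2 ^ (A + B + c)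
product-bound lo up (inj₁ refl) _ = inj₁ (n≤0⇒n≡0 up)
product-bound {F = F} {F₀} lo up (inj₂ _) (inj₁ refl) = inj₁ (n≤0⇒n≡0 (subst (F ≤_) (*-zeroʳ F₀) up))
product-bound {L} {F} {F₀} {F₁} {X} {c} {A} {B} lo up (inj₂ h₀) (inj₂ h₁) = inj₂ (begin
  L * (L * X)                         ≤⟨ *-mono-≤ h₀ (*-monoˡ-≤ X h₁) ⟩
  F₀ * 2 ^ A * (F₁ * 2 ^ B * X)       ≡⟨ regroup F₀ F₁ X (2 ^ A) (2 ^ B) ⟩
  2 ^ A * 2 ^ B * (F₀ * (F₁ * X))     ≤⟨ *-monoʳ-≤ (2 ^ A * 2 ^ B) lo ⟩
  2 ^ A * 2 ^ B * (2 ^ c * F)         ≡⟨ regroup′ F (2 ^ A) (2 ^ B) (2 ^ c) ⟩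
  F * (2 ^ A * 2 ^ B * 2 ^ c)         ≡⟨ cong (F *_) (trans (^-distribˡ-+-* 2 (A + B) c)
                                                              (cong (_* 2 ^ c) (^-distribˡ-+-* 2 A B))) ⟨
  F * 2 ^ (A + B + c)                 ∎)
  where
  open ≤-Reasoning
  regroup : ∀ F₀ F₁ X a b → F₀ * a * (F₁ * b * X) ≡ a * b * (F₀ * (F₁ * X))
  regroup = solve-∀
  regroup′ : ∀ F a b c → a * b * (c * F) ≡ F * (a * b * c)
  regroup′ = solve-∀

module Structure (t : ℕ) where

  size : ℕ → ℕ
  size n = 2 ^ suc n * t

  size-suc : ∀ n → size (suc n) ≡ size n + size n
  size-suc n = double (2 ^ suc n) t
    where
    double : ∀ x t → 2 * x * t ≡ x * t + x * t
    double = solve-∀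

  t≤size : ∀ n → t ≤ size n
  t≤size n = m≤n*m t (2 ^ suc n) {{>-nonZero (m^n>0 2 (suc n))}}

  -- the number of orderings of the final shuffled block of  2t  elements
  shuffles : ℕ
  shuffles = (t + t) !

  total : ℕ → ℕ
  total n = length (Dsuc t n)

  hits : ℕ → (ℕ → Bool) → ℕ → ℕ
  hits n p s = countᵇ (prefixAll p s) (Dsuc t n)

  Dsuc-↭ : ∀ n → All (λ π → π ↭ range (size n)) (Dsuc t n)
  Dsuc-↭ zero    = perms-↭ (range (2 * t))
  Dsuc-↭ (suc n) = All.concat⁺ (All.map⁺ (All.map (λ {σ₀} h₀ →
                     All.concat⁺ (All.map⁺ (All.map⁺ (All.map (λ {σ₁} h₁ →
                       All.map⁺ (All.map (λ hs → glue h₀ h₁ hs) (perms-↭ _))) (Dsuc-↭ n))))) (Dsuc-↭ n)))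
    where
    M = size n
    m = M ∸ t
    glue : ∀ {σ₀ σ₁ s'} → σ₀ ↭ range M → σ₁ ↭ range M → s' ↭ drop m σ₀ ++ drop m (map (_+ M) σ₁) →
           take m σ₀ ++ take m (map (_+ M) σ₁) ++ s' ↭ range (size (suc n))
    glue {σ₀} {σ₁} {s'} h₀ h₁ hs = begin
      take m σ₀ ++ take m σ₁' ++ s'                           ↭⟨ ++⁺ˡ (take m σ₀) (++⁺ˡ (take m σ₁') hs) ⟩
      take m σ₀ ++ take m σ₁' ++ drop m σ₀ ++ drop m σ₁'      ↭⟨ ++⁺ˡ (take m σ₀) (shifts (take m σ₁') (drop m σ₀)) ⟩
      take m σ₀ ++ drop m σ₀ ++ take m σ₁' ++ drop m σ₁'      ≡⟨ ++-assoc (take m σ₀) (drop m σ₀) _ ⟨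
      (take m σ₀ ++ drop m σ₀) ++ take m σ₁' ++ drop m σ₁'    ≡⟨ cong₂ _++_ (take++drop≡id m σ₀) (take++drop≡id m σ₁') ⟩
      σ₀ ++ σ₁'                                               ↭⟨ ++⁺ h₀ (map⁺ (_+ M) h₁) ⟩
      range M ++ map (_+ M) (range M)                         ≡⟨ range-double M ⟨
      range (M + M)                                           ≡⟨ cong range (size-suc n) ⟨
      range (size (suc n))                                    ∎
      where
      open PermutationReasoning
      σ₁' = map (_+ M) σ₁

  Bounded : ℕ → (ℕ → Bool) → ℕ → ℕ → Set
  Bounded n p s e = hits n p s ≡ 0 ⊎ total n ≤ hits n p s * 2 ^ e

  Bounded-mono : ∀ n p s {e e′} → e ≤ e′ → Bounded n p s e → Bounded n p s e′
  Bounded-mono n p s e≤e′ (inj₁ none) = inj₁ none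
  Bounded-mono n p s e≤e′ (inj₂ h) = inj₂ (≤-trans h (*-monoʳ-≤ (hits n p s) (^-monoʳ-≤ 2 e≤e′)))

  hits-impossible : ∀ n p s → s ≤ size n → countᵇ p (range (size n)) < s → hits n p s ≡ 0
  hits-impossible n p s s≤ = prefixAll-impossible p s (Dsuc t n) (range (size n)) (Dsuc-↭ n)
                               (subst (s ≤_) (sym (length-range (size n))) s≤)

  module Level (n : ℕ) where

    M = size n
    m = M ∸ t

    pool : List ℕ → List ℕ → List ℕ
    pool σ₀ σ₁ = drop m σ₀ ++ drop m (map (_+ M) σ₁)

    -- a predicate on the upper half  A₁, read on the unshifted ordering  σ₁
    shift : (ℕ → Bool) → ℕ → Bool
    shift p z = p (z + M)

    hitsFrom : (ℕ → Bool) → ℕ → List ℕ → List ℕ → ℕ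
    hitsFrom p s σ₀ σ₁ = countᵇ (λ s' → prefixAll p s (take m σ₀ ++ take m (map (_+ M) σ₁) ++ s')) (perms (pool σ₀ σ₁))

    data Position (s : ℕ) : Set where
      early  : s ≤ m → Position s
      middle : ∀ r → r ≤ m → m + r ≡ s → Position s
      late   : ∀ j → j ≤ t + t → m + (m + j) ≡ s → Position s

    M≡m+t : m + t ≡ M
    M≡m+t = m∸n+n≡m (t≤size n)

    position : ∀ s → s ≤ size (suc n) → Position s
    position s s≤ with s ≤? m | s ≤? m + m
    ... | yes s≤m | _        = early s≤m
    ... | no s≰m  | yes s≤2m = middle (s ∸ m) (+-cancelˡ-≤ m _ _ (subst (_≤ m + m) (sym m+r≡s) s≤2m)) m+r≡s
      where
      m+r≡s = m+[n∸m]≡n (<⇒≤ (≰⇒> s≰m))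
    ... | no _    | no s≰2m  = late (s ∸ (m + m)) (+-cancelˡ-≤ (m + m) _ _ (begin
        m + m + (s ∸ (m + m))   ≡⟨ m+[n∸m]≡n (<⇒≤ (≰⇒> s≰2m)) ⟩
        s                       ≤⟨ s≤ ⟩
        size (suc n)            ≡⟨ size-suc n ⟩
        M + M                   ≡⟨ cong₂ _+_ M≡m+t M≡m+t ⟨
        m + t + (m + t)         ≡⟨ regroup m t ⟩
        m + m + (t + t)         ∎))
        (trans (sym (+-assoc m m _)) (m+[n∸m]≡n (<⇒≤ (≰⇒> s≰2m))))
      where
      open ≤-Reasoning
      regroup : ∀ m t → m + t + (m + t) ≡ m + m + (t + t)
      regroup = solve-∀

    hits-suc : ∀ p s → hits (suc n) p s ≡ sumOf (λ σ₀ → sumOf (λ σ₁ → hitsFrom p s σ₀ σ₁) (Dsuc t n)) (Dsuc t n)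
    hits-suc p s = trans (countᵇ-concatMap (prefixAll p s) _ (Dsuc t n)) (sumOf-cong (Dsuc t n) (All.tabulate (λ {σ₀} _ →
      trans (countᵇ-concatMap (prefixAll p s) _ (map (map (_+ M)) (Dsuc t n)))
      (trans (sumOf-map _ (map (_+ M)) (Dsuc t n))
             (sumOf-cong (Dsuc t n) (All.tabulate (λ {σ₁} _ → countᵇ-map (prefixAll p s) _ (perms (pool σ₀ σ₁)))))))))

    m≤M : m ≤ M
    m≤M = m∸n≤m M t

    m≤length : ∀ {σ} → σ ↭ range M → m ≤ length σ
    m≤length h = subst (m ≤_) (sym (trans (↭-length h) (length-range M))) m≤M

    m≤length-shifted : ∀ {σ} → σ ↭ range M → m ≤ length (map (_+ M) σ)
    m≤length-shifted {σ} h = subst (m ≤_) (sym (length-map (_+ M) σ)) (m≤length h)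

    length-pool : ∀ {σ₀ σ₁} → σ₀ ↭ range M → σ₁ ↭ range M → length (pool σ₀ σ₁) ≡ t + t
    length-pool {σ₀} {σ₁} h₀ h₁ = trans (length-++ (drop m σ₀)) (cong₂ _+_ (dropped h₀) (trans
      (length-drop m (map (_+ M) σ₁)) (trans (cong (_∸ m) (length-map (_+ M) σ₁)) (dropped' h₁))))
      where
      dropped' : ∀ {σ} → σ ↭ range M → length σ ∸ m ≡ t
      dropped' h = trans (cong (_∸ m) (trans (↭-length h) (length-range M))) (m∸[m∸n]≡n (t≤size n))
      dropped : ∀ {σ} → σ ↭ range M → length (drop m σ) ≡ t
      dropped {σ} h = trans (length-drop m σ) (dropped' h)

    length-perms-pool : ∀ {σ₀ σ₁} → σ₀ ↭ range M → σ₁ ↭ range M → length (perms (pool σ₀ σ₁)) ≡ shuffles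
    length-perms-pool {σ₀} {σ₁} h₀ h₁ = trans (length-perms (pool σ₀ σ₁)) (cong _! (length-pool h₀ h₁))

    total-suc : total (suc n) ≡ total n * (total n * shuffles)
    total-suc = begin
      length (Dsuc t (suc n))                          ≡⟨ length-concatMap _ (Dsuc t n) ⟩
      sumOf (λ σ₀ → length (concatMap _ (map (map (_+ M)) (Dsuc t n)))) (Dsuc t n)
                                                       ≡⟨ sumOf-cong (Dsuc t n) (All.map inner (Dsuc-↭ n)) ⟩
      sumOf (λ σ₀ → total n * shuffles) (Dsuc t n)    ≡⟨ sumOf-const (total n * shuffles) (Dsuc t n) ⟩
      total n * (total n * shuffles)                   ∎
      where
      open ≡-Reasoning
      inner : ∀ {σ₀} → σ₀ ↭ range M → length (concatMap _ (map (map (_+ M)) (Dsuc t n))) ≡ total n * shuffles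
      inner {σ₀} h₀ = trans (length-concatMap _ (map (map (_+ M)) (Dsuc t n))) (trans (sumOf-map _ (map (_+ M)) (Dsuc t n))
        (trans (sumOf-cong (Dsuc t n) (All.map (λ {σ₁} h₁ → trans (length-map _ (perms (pool σ₀ σ₁))) (length-perms-pool h₀ h₁))
                                               (Dsuc-↭ n)))
               (sumOf-const shuffles (Dsuc t n))))

    -- the first  s ≤ m  entries of an outcome lie in the block taken from  σ₀
    hitsFrom-early : ∀ p s {σ₀ σ₁} → σ₀ ↭ range M → σ₁ ↭ range M → s ≤ m →
                     hitsFrom p s σ₀ σ₁ ≡ [ prefixAll p s σ₀ ]× shuffles
    hitsFrom-early p s {σ₀} {σ₁} h₀ h₁ s≤m = begin
      hitsFrom p s σ₀ σ₁                                      ≡⟨ countᵇ-cong (λ s' → prefixAll-within p σ₀ _ (m≤length h₀) s s≤m) (perms (pool σ₀ σ₁)) ⟩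
      countᵇ (λ _ → prefixAll p s σ₀) (perms (pool σ₀ σ₁))    ≡⟨ countᵇ-const (prefixAll p s σ₀) (perms (pool σ₀ σ₁)) ⟩
      [ prefixAll p s σ₀ ]× length (perms (pool σ₀ σ₁))       ≡⟨ cong ([ prefixAll p s σ₀ ]×_) (length-perms-pool h₀ h₁) ⟩
      [ prefixAll p s σ₀ ]× shuffles                          ∎
      where open ≡-Reasoning

    -- for  m < s ≤ 2m  they consist of the block from  σ₀  and the start of the block from  σ₁
    hitsFrom-middle : ∀ p r {σ₀ σ₁} → σ₀ ↭ range M → σ₁ ↭ range M → r ≤ m →
                      hitsFrom p (m + r) σ₀ σ₁ ≡ [ prefixAll p m σ₀ ]× [ prefixAll (shift p) r σ₁ ]× shuffles
    hitsFrom-middle p r {σ₀} {σ₁} h₀ h₁ r≤m = begin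
      hitsFrom p (m + r) σ₀ σ₁                                  ≡⟨ countᵇ-cong split (perms (pool σ₀ σ₁)) ⟩
      countᵇ (λ _ → prefixAll p m σ₀ ∧ prefixAll (shift p) r σ₁) (perms (pool σ₀ σ₁))
                                                                ≡⟨ countᵇ-const _ (perms (pool σ₀ σ₁)) ⟩
      [ prefixAll p m σ₀ ∧ prefixAll (shift p) r σ₁ ]× length (perms (pool σ₀ σ₁))
                                                                ≡⟨ cong ([ prefixAll p m σ₀ ∧ prefixAll (shift p) r σ₁ ]×_) (length-perms-pool h₀ h₁) ⟩
      [ prefixAll p m σ₀ ∧ prefixAll (shift p) r σ₁ ]× shuffles ≡⟨ []×-∧ (prefixAll p m σ₀) _ shuffles ⟩
      [ prefixAll p m σ₀ ]× [ prefixAll (shift p) r σ₁ ]× shuffles ∎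
      where
      open ≡-Reasoning
      σ₁' = map (_+ M) σ₁
      split : ∀ s' → prefixAll p (m + r) (take m σ₀ ++ take m σ₁' ++ s') ≡ (prefixAll p m σ₀ ∧ prefixAll (shift p) r σ₁)
      split s' = trans (prefixAll-beyond p σ₀ _ (m≤length h₀) r)
        (cong (prefixAll p m σ₀ ∧_) (trans (prefixAll-within p σ₁' s' (m≤length-shifted h₁) r r≤m)
                                           (prefixAll-map p (_+ M) r σ₁)))

    -- beyond  2m  they also involve the start of the shuffled pool
    hitsFrom-late : ∀ p j {σ₀ σ₁} → σ₀ ↭ range M → σ₁ ↭ range M →
                    hitsFrom p (m + (m + j)) σ₀ σ₁ ≡ [ prefixAll p m σ₀ ]× [ prefixAll (shift p) m σ₁ ]× goodPerms p (pool σ₀ σ₁) j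
    hitsFrom-late p j {σ₀} {σ₁} h₀ h₁ = begin
      hitsFrom p (m + (m + j)) σ₀ σ₁                            ≡⟨ countᵇ-cong split (perms (pool σ₀ σ₁)) ⟩
      countᵇ (λ s' → prefixAll p m σ₀ ∧ (prefixAll (shift p) m σ₁ ∧ prefixAll p j s')) (perms (pool σ₀ σ₁))
                                                                ≡⟨ countᵇ-∧ (prefixAll p m σ₀) _ (perms (pool σ₀ σ₁)) ⟩
      [ prefixAll p m σ₀ ]× countᵇ (λ s' → prefixAll (shift p) m σ₁ ∧ prefixAll p j s') (perms (pool σ₀ σ₁))
                                                                ≡⟨ cong ([ prefixAll p m σ₀ ]×_) (countᵇ-∧ (prefixAll (shift p) m σ₁) (prefixAll p j) (perms (pool σ₀ σ₁))) ⟩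
      [ prefixAll p m σ₀ ]× [ prefixAll (shift p) m σ₁ ]× goodPerms p (pool σ₀ σ₁) j ∎
      where
      open ≡-Reasoning
      σ₁' = map (_+ M) σ₁
      split : ∀ s' → prefixAll p (m + (m + j)) (take m σ₀ ++ take m σ₁' ++ s') ≡
                     (prefixAll p m σ₀ ∧ (prefixAll (shift p) m σ₁ ∧ prefixAll p j s'))
      split s' = trans (prefixAll-beyond p σ₀ _ (m≤length h₀) (m + j))
        (cong (prefixAll p m σ₀ ∧_) (trans (prefixAll-beyond p σ₁' s' (m≤length-shifted h₁) j)
                                           (cong (_∧ prefixAll p j s') (prefixAll-map p (_+ M) m σ₁))))

    hits-early : ∀ p s → s ≤ m → hits (suc n) p s ≡ hits n p s * (total n * shuffles)
    hits-early p s s≤m = begin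
      hits (suc n) p s
        ≡⟨ hits-suc p s ⟩
      sumOf (λ σ₀ → sumOf (λ σ₁ → hitsFrom p s σ₀ σ₁) (Dsuc t n)) (Dsuc t n)
        ≡⟨ sumOf-cong (Dsuc t n) (All.map (λ {σ₀} h₀ → trans
             (sumOf-cong (Dsuc t n) (All.map (λ h₁ → hitsFrom-early p s h₀ h₁ s≤m) (Dsuc-↭ n)))
             (trans (sumOf-const _ (Dsuc t n)) ([]×-commˡ (prefixAll p s σ₀) (total n) shuffles))) (Dsuc-↭ n)) ⟩
      sumOf (λ σ₀ → [ prefixAll p s σ₀ ]× (total n * shuffles)) (Dsuc t n)
        ≡⟨ sumOf-guard (prefixAll p s) (total n * shuffles) (Dsuc t n) ⟩
      hits n p s * (total n * shuffles) ∎
      where open ≡-Reasoning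

    hits-middle : ∀ p r → r ≤ m → hits (suc n) p (m + r) ≡ hits n p m * (hits n (shift p) r * shuffles)
    hits-middle p r r≤m = begin
      hits (suc n) p (m + r)
        ≡⟨ hits-suc p (m + r) ⟩
      sumOf (λ σ₀ → sumOf (λ σ₁ → hitsFrom p (m + r) σ₀ σ₁) (Dsuc t n)) (Dsuc t n)
        ≡⟨ sumOf-cong (Dsuc t n) (All.map (λ {σ₀} h₀ → trans
             (sumOf-cong (Dsuc t n) (All.map (λ h₁ → hitsFrom-middle p r h₀ h₁ r≤m) (Dsuc-↭ n)))
             (trans (sumOf-guardOut (prefixAll p m σ₀) (λ σ₁ → [ prefixAll (shift p) r σ₁ ]× shuffles) (Dsuc t n))
                    (cong ([ prefixAll p m σ₀ ]×_) (sumOf-guard (prefixAll (shift p) r) shuffles (Dsuc t n))))) (Dsuc-↭ n)) ⟩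
      sumOf (λ σ₀ → [ prefixAll p m σ₀ ]× (hits n (shift p) r * shuffles)) (Dsuc t n)
        ≡⟨ sumOf-guard (prefixAll p m) _ (Dsuc t n) ⟩
      hits n p m * (hits n (shift p) r * shuffles) ∎
      where open ≡-Reasoning

    lateSum : (ℕ → Bool) → ℕ → ℕ
    lateSum p j = sumOf (λ σ₀ → [ prefixAll p m σ₀ ]×
                    sumOf (λ σ₁ → [ prefixAll (shift p) m σ₁ ]× goodPerms p (pool σ₀ σ₁) j) (Dsuc t n)) (Dsuc t n)

    hits-late : ∀ p j → hits (suc n) p (m + (m + j)) ≡ lateSum p j
    hits-late p j = trans (hits-suc p (m + (m + j))) (sumOf-cong (Dsuc t n) (All.map (λ {σ₀} h₀ → trans
      (sumOf-cong (Dsuc t n) (All.map (λ h₁ → hitsFrom-late p j h₀ h₁) (Dsuc-↭ n)))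
      (sumOf-guardOut (prefixAll p m σ₀) (λ σ₁ → [ prefixAll (shift p) m σ₁ ]× goodPerms p (pool σ₀ σ₁) j) (Dsuc t n)))
      (Dsuc-↭ n)))

    count-range-suc : ∀ p → countᵇ p (range (size (suc n))) ≡ countᵇ p (range M) + countᵇ (shift p) (range M)
    count-range-suc p = begin
      countᵇ p (range (size (suc n)))                       ≡⟨ cong (λ k → countᵇ p (range k)) (size-suc n) ⟩
      countᵇ p (range (M + M))                              ≡⟨ cong (countᵇ p) (range-double M) ⟩
      countᵇ p (range M ++ map (_+ M) (range M))            ≡⟨ countᵇ-++ p (range M) _ ⟩
      countᵇ p (range M) + countᵇ p (map (_+ M) (range M))  ≡⟨ cong (countᵇ p (range M) +_) (countᵇ-map p (_+ M) (range M)) ⟩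
      countᵇ p (range M) + countᵇ (shift p) (range M)       ∎
      where open ≡-Reasoning

    count-pool : ∀ p {σ₀ σ₁} → σ₀ ↭ range M → σ₁ ↭ range M → prefixAll p m σ₀ ≡ true → prefixAll (shift p) m σ₁ ≡ true →
                 countᵇ p (pool σ₀ σ₁) + (m + m) ≡ countᵇ p (range (size (suc n)))
    count-pool p {σ₀} {σ₁} h₀ h₁ e₀ e₁ = begin
      countᵇ p (pool σ₀ σ₁) + (m + m)                              ≡⟨ cong (_+ (m + m)) (countᵇ-++ p (drop m σ₀) _) ⟩
      countᵇ p (drop m σ₀) + countᵇ p (drop m σ₁') + (m + m)       ≡⟨ regroup (countᵇ p (drop m σ₀)) _ m ⟩
      (countᵇ p (drop m σ₀) + m) + (countᵇ p (drop m σ₁') + m)     ≡⟨ cong₂ _+_ (count-drop p m σ₀ e₀ (m≤length h₀))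
                                                                      (count-drop p m σ₁' e₁' (m≤length-shifted h₁)) ⟩
      countᵇ p σ₀ + countᵇ p σ₁'                                   ≡⟨ cong₂ _+_ (countᵇ-↭ p h₀)
                                                                      (trans (countᵇ-map p (_+ M) σ₁) (countᵇ-↭ (shift p) h₁)) ⟩
      countᵇ p (range M) + countᵇ (shift p) (range M)              ≡⟨ count-range-suc p ⟨
      countᵇ p (range (size (suc n)))                              ∎
      where
      open ≡-Reasoning
      σ₁' = map (_+ M) σ₁
      e₁' : prefixAll p m σ₁' ≡ true
      e₁' = trans (prefixAll-map p (_+ M) m σ₁) e₁
      regroup : ∀ a b m → a + b + (m + m) ≡ (a + m) + (b + m)
      regroup = solve-∀

    bounded-product : ∀ p s F₀ F₁ c A B → F₀ * (F₁ * shuffles) ≤ 2 ^ c * hits (suc n) p s →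
                      hits (suc n) p s ≤ F₀ * (F₁ * shuffles) →
                      F₀ ≡ 0 ⊎ total n ≤ F₀ * 2 ^ A → F₁ ≡ 0 ⊎ total n ≤ F₁ * 2 ^ B → Bounded (suc n) p s (A + B + c)
    bounded-product p s F₀ F₁ c A B lo up b₀ b₁ with product-bound {c = c} {A} {B} lo up b₀ b₁
    ... | inj₁ none = inj₁ none
    ... | inj₂ h    = inj₂ (subst (_≤ hits (suc n) p s * 2 ^ (A + B + c)) (sym total-suc) h)

    -- the first  s ≤ m  entries come from  σ₀ : the fraction of hits does not change
    bounded-early : ∀ p s e → s ≤ m → Bounded n p s e → Bounded (suc n) p s e
    bounded-early p s e s≤m b =
      Bounded-mono (suc n) p s (≤-reflexive (trans (+-identityʳ (e + 0)) (+-identityʳ e)))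
        (bounded-product p s (hits n p s) (total n) 0 e 0 (≤-reflexive (trans (sym split) (sym (*-identityˡ _)))) (≤-reflexive split)
                         b (inj₂ (≤-reflexive (sym (*-identityʳ (total n))))))
      where
      split = hits-early p s s≤m

    -- for  m < s ≤ 2m  the events on  σ₀  and  σ₁  are independent
    bounded-middle : ∀ p r A B → r ≤ m → Bounded n p m A → Bounded n (shift p) r B → Bounded (suc n) p (m + r) (A + B)
    bounded-middle p r A B r≤m b₀ b₁ =
      Bounded-mono (suc n) p (m + r) (≤-reflexive (+-identityʳ (A + B)))
        (bounded-product p (m + r) (hits n p m) (hits n (shift p) r) 0 A B (≤-reflexive (trans (sym split) (sym (*-identityˡ _)))) (≤-reflexive split) b₀ b₁)
      where
      split = hits-middle p r r≤m

    bounded-late : ∀ p j c A B →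
                   (∀ ℓ → length ℓ ≡ t + t → countᵇ p ℓ + (m + m) ≡ countᵇ p (range (size (suc n))) →
                      shuffles ≤ 2 ^ c * goodPerms p ℓ j) →
                   Bounded n p m A → Bounded n (shift p) m B → Bounded (suc n) p (m + (m + j)) (A + B + c)
    bounded-late p j c A B poolBound b₀ b₁ =
      bounded-product p (m + (m + j)) (hits n p m) (hits n (shift p) m) c A B
      (subst (λ h → hits n p m * (hits n (shift p) m * shuffles) ≤ 2 ^ c * h) (sym (hits-late p j))
        (guardedSum-≥ (prefixAll p m) _ (hits n (shift p) m * shuffles) (2 ^ c) (Dsuc t n) (Dsuc-↭ n) (λ σ₀ h₀ e₀ →
          guardedSum-≥ (prefixAll (shift p) m) (λ σ₁ → goodPerms p (pool σ₀ σ₁) j) shuffles (2 ^ c) (Dsuc t n) (Dsuc-↭ n) (λ σ₁ h₁ e₁ →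
            poolBound (pool σ₀ σ₁) (length-pool h₀ h₁) (count-pool p h₀ h₁ e₀ e₁)))))
      (subst (_≤ hits n p m * (hits n (shift p) m * shuffles)) (sym (hits-late p j))
        (guardedSum-≤ (prefixAll p m) _ (hits n (shift p) m * shuffles) (Dsuc t n) (Dsuc-↭ n) (λ σ₀ h₀ →
          guardedSum-≤ (prefixAll (shift p) m) (λ σ₁ → goodPerms p (pool σ₀ σ₁) j) shuffles (Dsuc t n) (Dsuc-↭ n) (λ σ₁ h₁ →
            subst (goodPerms p (pool σ₀ σ₁) j ≤_) (length-perms-pool h₀ h₁) (countᵇ-≤ (prefixAll p j) (perms (pool σ₀ σ₁)))))))
      b₀ b₁

    late-vanish : ∀ p j → j ≤ t + t → countᵇ p (range (size (suc n))) < m + (m + j) → hits (suc n) p (m + (m + j)) ≡ 0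
    late-vanish p j j≤ short = trans (hits-late p j)
      (guardedSum-0 (prefixAll p m) _ (Dsuc t n) (Dsuc-↭ n) (λ σ₀ h₀ e₀ →
        guardedSum-0 (prefixAll (shift p) m) (λ σ₁ → goodPerms p (pool σ₀ σ₁) j) (Dsuc t n) (Dsuc-↭ n) (λ σ₁ h₁ e₁ →
          prefixAll-impossible p j (perms (pool σ₀ σ₁)) (pool σ₀ σ₁) (perms-↭ (pool σ₀ σ₁))
            (subst (j ≤_) (sym (length-pool h₀ h₁)) j≤)
            (+-cancelʳ-< (m + m) _ j (subst₂ _<_ (sym (count-pool p h₀ h₁ e₀ e₁)) (reorder m j) short)))))
      where
      reorder : ∀ m j → m + (m + j) ≡ j + (m + m)
      reorder = solve-∀

  private
    ≤-by : ∀ {a b} k → a + k ≡ b → a ≤ b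
    ≤-by {a} k eq = subst (a ≤_) eq (m≤m+n a k)

    count≤size : ∀ n p → countᵇ p (range (size n)) ≤ size n
    count≤size n p = subst (countᵇ p (range (size n)) ≤_) (length-range (size n)) (countᵇ-≤ p (range (size n)))

    size₀ : size 0 ≡ t + t
    size₀ = double t
      where
      double : ∀ t → 2 ^ 1 * t ≡ t + t
      double = solve-∀

  boundary-bound : ∀ n p y → y ≤ t → countᵇ p (range (size n)) + y ≡ size n → Bounded n p (size n ∸ t) (2 * (suc n * y))
  boundary-bound zero p y y≤t hy = subst (λ s → Bounded 0 p s (2 * (1 * y))) t≡size₀∸t (inj₂ (begin
    total 0                                 ≡⟨ length-perms ℓ ⟩
    length ℓ !                              ≡⟨ cong _! length-ℓ ⟩
    (t + t) !                               ≤⟨ goodPerms-bound-half p ℓ t y y≤t length-ℓ (trans hy size₀) ⟩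
    2 ^ (2 * y) * goodPerms p ℓ t           ≡⟨ *-comm (2 ^ (2 * y)) _ ⟩
    hits 0 p t * 2 ^ (2 * y)                ≡⟨ cong (λ k → hits 0 p t * 2 ^ (2 * k)) (*-identityˡ y) ⟨
    hits 0 p t * 2 ^ (2 * (1 * y))          ∎))
    where
    open ≤-Reasoning
    ℓ = range (size 0)
    length-ℓ : length ℓ ≡ t + t
    length-ℓ = trans (length-range (size 0)) size₀
    t≡size₀∸t : t ≡ size 0 ∸ t
    t≡size₀∸t = trans (sym (m+n∸n≡m t t)) (cong (_∸ t) (sym size₀))
  boundary-bound (suc n) p y y≤t hy =
    subst (λ s → Bounded (suc n) p s (2 * (suc (suc n) * y))) (sym boundary-position)
      (Bounded-mono (suc n) p (m + (m + t)) (≤-reflexive exponent-sum)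
        (bounded-late p t (2 * y) (2 * (suc n * y₀)) (2 * (suc n * y₁)) poolBound (boundary-bound n p y₀ (≤-trans y₀≤y y≤t) (m+[n∸m]≡n (P≤M p)))
                                (boundary-bound n (shift p) y₁ (≤-trans y₁≤y y≤t) (m+[n∸m]≡n (P≤M (shift p))))))
    where
    open Level n
    P≤M : ∀ q → countᵇ q (range M) ≤ M
    P≤M q = subst (countᵇ q (range M) ≤_) (length-range M) (countᵇ-≤ q (range M))
    y₀ = M ∸ countᵇ p (range M)
    y₁ = M ∸ countᵇ (shift p) (range M)
    -- the  y  failures are those of the two halves
    y≡y₀+y₁ : y ≡ y₀ + y₁
    y≡y₀+y₁ = +-cancelˡ-≡ (countᵇ p (range M) + countᵇ (shift p) (range M)) y (y₀ + y₁) (begin-equality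
      countᵇ p (range M) + countᵇ (shift p) (range M) + y  ≡⟨ cong (_+ y) (count-range-suc p) ⟨
      countᵇ p (range (size (suc n))) + y                  ≡⟨ trans hy (size-suc n) ⟩
      M + M                                                ≡⟨ cong₂ _+_ (m+[n∸m]≡n (P≤M p)) (m+[n∸m]≡n (P≤M (shift p))) ⟨
      countᵇ p (range M) + y₀ + (countᵇ (shift p) (range M) + y₁) ≡⟨ regroup (countᵇ p (range M)) (countᵇ (shift p) (range M)) y₀ y₁ ⟩
      countᵇ p (range M) + countᵇ (shift p) (range M) + (y₀ + y₁) ∎)
      where
      open ≤-Reasoning
      regroup : ∀ a b c d → a + c + (b + d) ≡ a + b + (c + d)
      regroup = solve-∀
    y₀≤y : y₀ ≤ y
    y₀≤y = subst (y₀ ≤_) (sym y≡y₀+y₁) (m≤m+n y₀ y₁)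
    y₁≤y : y₁ ≤ y
    y₁≤y = subst (y₁ ≤_) (sym y≡y₀+y₁) (m≤n+m y₁ y₀)
    boundary-position : size (suc n) ∸ t ≡ m + (m + t)
    boundary-position = trans (cong (_∸ t) (size-suc n)) (trans (+-∸-comm M (t≤size n)) (cong (m +_) (sym M≡m+t)))
    exponent-sum : 2 * (suc n * y₀) + 2 * (suc n * y₁) + 2 * y ≡ 2 * (suc (suc n) * y)
    exponent-sum = trans (cong (λ z → 2 * (suc n * y₀) + 2 * (suc n * y₁) + 2 * z) y≡y₀+y₁)
                         (trans (distribute n y₀ y₁) (cong (λ z → 2 * (suc (suc n) * z)) (sym y≡y₀+y₁)))
      where
      distribute : ∀ n y₀ y₁ → 2 * (suc n * y₀) + 2 * (suc n * y₁) + 2 * (y₀ + y₁) ≡ 2 * (suc (suc n) * (y₀ + y₁))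
      distribute = solve-∀
    -- an admissible pool misses exactly the  y  failures
    poolBound : ∀ ℓ → length ℓ ≡ t + t → countᵇ p ℓ + (m + m) ≡ countᵇ p (range (size (suc n))) →
                shuffles ≤ 2 ^ (2 * y) * goodPerms p ℓ t
    poolBound ℓ hℓ hc = goodPerms-bound-half p ℓ t y y≤t hℓ (+-cancelʳ-≡ (m + m) _ _ (begin-equality
      countᵇ p ℓ + y + (m + m)                ≡⟨ regroup (countᵇ p ℓ) y (m + m) ⟩
      countᵇ p ℓ + (m + m) + y                ≡⟨ cong (_+ y) hc ⟩
      countᵇ p (range (size (suc n))) + y     ≡⟨ trans hy (size-suc n) ⟩
      M + M                                   ≡⟨ cong₂ _+_ M≡m+t M≡m+t ⟨
      m + t + (m + t)                         ≡⟨ regroup′ m t ⟩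
      t + t + (m + m)                         ∎))
      where
      open ≤-Reasoning
      regroup : ∀ a b c → a + b + c ≡ a + c + b
      regroup = solve-∀
      regroup′ : ∀ m t → m + t + (m + t) ≡ t + t + (m + m)
      regroup′ = solve-∀

  -- the boundary bound for the worst case  y = t ; with more failures there are no hits
  boundary-bound-t : ∀ n p → Bounded n p (size n ∸ t) (2 * (suc n * t))
  boundary-bound-t n p with size n ∸ countᵇ p (range (size n)) ≤? t
  ... | yes y≤t = Bounded-mono n p (size n ∸ t) (*-monoʳ-≤ 2 (*-monoʳ-≤ (suc n) y≤t))
                    (boundary-bound n p _ y≤t (m+[n∸m]≡n (count≤size n p)))
  ... | no y≰t  = inj₁ (hits-impossible n p (size n ∸ t) (m∸n≤m (size n) t)
                    (m+n≤o⇒m≤o∸n (suc P) (subst (suc (P + t) ≤_) (m+[n∸m]≡n (count≤size n p)) (+-monoʳ-< P (≰⇒> y≰t)))))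
    where
    P = countᵇ p (range (size n))

  exponent : ℕ → ℕ
  exponent n = 2 * (suc n * suc n) * t

  module Induction (n : ℕ) (IH : ∀ p s → s ≤ size n → Bounded n p s (exponent n)) where
    open Level n

    private
      exponent-early : exponent n ≤ exponent (suc n)
      exponent-early = ≤-by (2 * (2 * n + 3) * t) (expand n t)
        where
        expand : ∀ n t → 2 * (suc n * suc n) * t + 2 * (2 * n + 3) * t ≡ 2 * (suc (suc n) * suc (suc n)) * t
        expand = solve-∀

      exponent-middle : 2 * (suc n * t) + exponent n ≤ exponent (suc n)
      exponent-middle = ≤-by (2 * (n + 2) * t) (expand n t)
        where
        expand : ∀ n t → 2 * (suc n * t) + 2 * (suc n * suc n) * t + 2 * (n + 2) * t ≡ 2 * (suc (suc n) * suc (suc n)) * t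
        expand = solve-∀

      exponent-late : 2 * (suc n * t) + 2 * (suc n * t) + (t + t) ≤ exponent (suc n)
      exponent-late = ≤-by (2 * (n * n + 2 * n + 1) * t) (expand n t)
        where
        expand : ∀ n t → 2 * (suc n * t) + 2 * (suc n * t) + (t + t) + 2 * (n * n + 2 * n + 1) * t ≡
                         2 * (suc (suc n) * suc (suc n)) * t
        expand = solve-∀

    step : ∀ p s → s ≤ size (suc n) → Bounded (suc n) p s (exponent (suc n))
    step p s s≤ with position s s≤
    ... | early s≤m = Bounded-mono (suc n) p s exponent-early
            (bounded-early p s (exponent n) s≤m (IH p s (≤-trans s≤m m≤M)))
    ... | middle r r≤m refl = Bounded-mono (suc n) p (m + r) exponent-middle
            (bounded-middle p r (2 * (suc n * t)) (exponent n) r≤m (boundary-bound-t n p) (IH (shift p) r (≤-trans r≤m m≤M)))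
    ... | late j j≤ refl with m + (m + j) ≤? countᵇ p (range (size (suc n)))
    ...   | no short   = inj₁ (late-vanish p j j≤ (≰⇒> short))
    ...   | yes enough = Bounded-mono (suc n) p (m + (m + j)) exponent-late
            (bounded-late p j (t + t) (2 * (suc n * t)) (2 * (suc n * t)) poolBound (boundary-bound-t n p) (boundary-bound-t n (shift p)))
      where
      -- the pool holds at least  j  elements satisfying  p
      poolBound : ∀ ℓ → length ℓ ≡ t + t → countᵇ p ℓ + (m + m) ≡ countᵇ p (range (size (suc n))) →
                  shuffles ≤ 2 ^ (t + t) * goodPerms p ℓ j
      poolBound ℓ hℓ hc = subst (λ k → k ! ≤ 2 ^ k * goodPerms p ℓ j) hℓ
        (goodPerms-bound p ℓ j (+-cancelʳ-≤ (m + m) j _ (subst₂ _≤_ (regroup m j) (sym hc) enough))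
                               (subst (j ≤_) (sym hℓ) j≤))
        where
        regroup : ∀ m j → m + (m + j) ≡ j + (m + m)
        regroup = solve-∀

  hits-bound : ∀ n p s → s ≤ size n → Bounded n p s (exponent n)
  hits-bound zero p s s≤ with s ≤? countᵇ p (range (size 0))
  ... | no s≰P  = inj₁ (hits-impossible 0 p s s≤ (≰⇒> s≰P))
  ... | yes s≤P = inj₂ (begin
      total 0                       ≡⟨ length-perms (range (size 0)) ⟩
      length (range (size 0)) !     ≤⟨ goodPerms-bound p (range (size 0)) s s≤P (subst (s ≤_) (sym (length-range (size 0))) s≤) ⟩
      2 ^ length (range (size 0)) * hits 0 p s ≡⟨ *-comm _ (hits 0 p s) ⟩
      hits 0 p s * 2 ^ length (range (size 0)) ≡⟨ cong (λ k → hits 0 p s * 2 ^ k) (trans (length-range (size 0)) size≡exponent) ⟩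
      hits 0 p s * 2 ^ exponent 0   ∎)
    where
    open ≤-Reasoning
    size≡exponent : size 0 ≡ exponent 0
    size≡exponent = same t
      where
      same : ∀ t → 2 ^ 1 * t ≡ 2 * (1 * 1) * t
      same = solve-∀
  hits-bound (suc n) = Induction.step n (hits-bound n)

without : ℕ → List ℕ → List ℕ
without x = filter (λ z → ¬? (z ≟ x))

length-without : ∀ {x} (Y : List ℕ) → x ∈ Y → length (without x Y) < length Y
length-without {x} Y x∈Y = filter-notAll (λ z → ¬? (z ≟ x)) Y (Any.map (λ x≡z z≢x → z≢x (sym x≡z)) x∈Y)

∈-without : ∀ {x z} {Y : List ℕ} → z ∈ Y → z ≢ x → z ∈ without x Y
∈-without {x} = ∈-filter⁺ (λ z → ¬? (z ≟ x))

unique-⊆⇒≤ : ∀ {T Y : List ℕ} → Unique T → T ⊆ Y → length T ≤ length Y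
unique-⊆⇒≤ {[]}    _          _   = z≤n
unique-⊆⇒≤ {a ∷ T} {Y} (a∉T ∷ u) sub = ≤-trans (s≤s (unique-⊆⇒≤ u (λ z∈T →
  ∈-without (sub (there z∈T)) (λ z≡a → All.lookup a∉T z∈T (sym z≡a))))) (length-without Y (sub (here refl)))

unique-⊆-long⇒⊇ : ∀ {T X : List ℕ} → Unique T → T ⊆ X → length X ≤ length T → X ⊆ T
unique-⊆-long⇒⊇ {T} {X} u sub X≤T {x} x∈X with x ∈? T
... | yes x∈T = x∈T
... | no  x∉T = ⊥-elim (<⇒≱ (length-without X x∈X) (≤-trans X≤T (unique-⊆⇒≤ u (λ z∈T →
                  ∈-without (sub z∈T) (λ z≡x → x∉T (subst (_∈ T) z≡x z∈T))))))

member : List ℕ → ℕ → Bool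
member X x = does (x ∈? X)

member⇒∈ : ∀ X x → member X x ≡ true → x ∈ X
member⇒∈ X x h with x ∈? X
... | yes x∈X = x∈X

∈⇒member : ∀ X x → x ∈ X → member X x ≡ true
∈⇒member X x x∈X with x ∈? X
... | yes _   = refl
... | no  x∉X = ⊥-elim (x∉X x∈X)

prefixAll⇒All : ∀ p s (π : List ℕ) → prefixAll p s π ≡ true → All (λ x → p x ≡ true) (take s π)
prefixAll⇒All p zero    π        h = []
prefixAll⇒All p (suc s) []       h = []
prefixAll⇒All p (suc s) (x ∷ π)  h with p x in px
... | true = px ∷ prefixAll⇒All p s π h

All⇒prefixAll : ∀ p s (π : List ℕ) → All (λ x → p x ≡ true) (take s π) → prefixAll p s π ≡ true
All⇒prefixAll p zero    π       h        = refl
All⇒prefixAll p (suc s) []      h        = refl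
All⇒prefixAll p (suc s) (x ∷ π) (px ∷ h) rewrite px = All⇒prefixAll p s π h

length-filter≡countᵇ : {A : Set} {Q : A → Set} (Q? : (x : A) → Dec (Q x)) (b : A → Bool) (xs : List A) →
                       All (λ x → (Q x → b x ≡ true) × (b x ≡ true → Q x)) xs → length (filter Q? xs) ≡ countᵇ b xs
length-filter≡countᵇ Q? b []       []                = refl
length-filter≡countᵇ Q? b (x ∷ xs) ((to , from) ∷ hs) with Q? x | b x
... | yes q  | true  = cong suc (length-filter≡countᵇ Q? b xs hs)
... | yes q  | false = case to q of λ ()
... | no ¬q  | true  = ⊥-elim (¬q (from refl))
... | no ¬q  | false = length-filter≡countᵇ Q? b xs hs

Event⇔prefixAll : ∀ {N} (X : List ℕ) (π : List ℕ) → π ↭ range N → length X ≤ N →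
                  (Event X π → prefixAll (member X) (length X) π ≡ true) × (prefixAll (member X) (length X) π ≡ true → Event X π)
Event⇔prefixAll {N} X π π↭ s≤N =
  (λ (into , _) → All⇒prefixAll (member X) s π (All.tabulate (λ {x} x∈ → ∈⇒member X x (into x∈)))) ,
  (λ h → into h , unique-⊆-long⇒⊇ uniquePrefix (into h) (≤-reflexive (sym length-prefix)))
  where
  s = length X
  into : prefixAll (member X) s π ≡ true → take s π ⊆ X
  into h x∈ = member⇒∈ X _ (All.lookup (prefixAll⇒All (member X) s π h) x∈)
  uniquePrefix : Unique (take s π)
  uniquePrefix = Unique.take⁺ s (Unique-resp-↭ (setoid ℕ) (↭⇒↭ₛ (Perm.↭-sym π↭)) (Unique.map⁺ suc-injective (Unique.upTo⁺ N)))
  length-prefix : length (take s π) ≡ s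
  length-prefix = trans (length-take s π) (m≤n⇒m⊓n≡m (subst (s ≤_) (sym (trans (↭-length π↭) (length-range N))) s≤N))

-- the event of the lemma is the hit event for membership in  X
lemma6 : (t k : ℕ) → 1 ≤ t → 1 ≤ k →
         (X : List ℕ) → Unique X → All (λ x → 1 ≤ x × x ≤ 2 ^ k * t) X →
         count t k X ≡ 0 ⊎ length (D t k) ≤ count t k X * 2 ^ (2 * (k * k) * t)
lemma6 t (suc n) _ _ X uniqueX inRange = subst (λ c → c ≡ 0 ⊎ total n ≤ c * 2 ^ exponent n) (sym count≡hits)
  (hits-bound n (member X) (length X) s≤N)
  where
  open Structure t
  -- X is a subset of [2^k t], so it has at most  2^k t  elements
  s≤N : length X ≤ size n
  s≤N = subst (length X ≤_) (length-range (size n)) (unique-⊆⇒≤ uniqueX (λ x∈X →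
          let (1≤x , x≤N) = All.lookup inRange x∈X in ∈-range 1≤x x≤N))
    where
    ∈-range : ∀ {x N} → 1 ≤ x → x ≤ N → x ∈ range N
    ∈-range {suc x} (s≤s z≤n) (s≤s x<N) = ∈-map⁺ suc (∈-upTo⁺ (s≤s x<N))
  count≡hits : count t (suc n) X ≡ hits n (member X) (length X)
  count≡hits = length-filter≡countᵇ _ (prefixAll (member X) (length X)) (Dsuc t n)
                 (All.map (λ π↭ → Event⇔prefixAll X _ π↭ s≤N) (Dsuc-↭ n))
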